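{- Let $n \ge 0$. If $A_{\mathbb{Z}[i],j} = B_j$ for all $0 \le j \le n$, then $(1+i)B_n \subset A_{\mathbb{Z}[i],n+1}$.
   Context: $A_{\mathbb{Z}[i],0} = \{0,\pm 1,\pm i\}$, and for $n\ge 1$, $A_{\mathbb{Z}[i],n} = A_{\mathbb{Z}[i],n-1} \cup \{\beta \in \mathbb{Z}[i] : \text{every residue class of } \mathbb{Z}[i]/(\beta) \text{ has a representative in } A_{\mathbb{Z}[i],n-1}\}$. For $n\ge 0$, $B_n = \left\{ \sum_{j=0}^n v_j (1+i)^j : v_j \in \{0,\pm 1,\pm i\}\right\}$, and $(1+i)B_n = \{(1+i)x : x\in B_n\}$. -}

module Defs where

open import Data.Nat using (ℕ; zero; suc)
open import Data.Integer as ℤ using (ℤ; +_; -[1+_])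
open import Data.Fin using (Fin; toℕ) renaming (zero to fzero; suc to fsuc)
open import Data.Product using (Σ; ∃; _×_; _,_)
open import Data.Sum using (_⊎_)
open import Relation.Binary.PropositionalEquality using (_≡_)

record ℤ[i] : Set where
  constructor _+_i
  field
    re : ℤ
    im : ℤ
open ℤ[i] public

infixl 6 _+G_ _-G_
infixl 7 _*G_

_+G_ : ℤ[i] → ℤ[i] → ℤ[i]
(a + b i) +G (c + d i) = (a ℤ.+ c) + (b ℤ.+ d) i

-G_ : ℤ[i] → ℤ[i]
-G (a + b i) = (ℤ.- a) + (ℤ.- b) i

_-G_ : ℤ[i] → ℤ[i] → ℤ[i]
x -G y = x +G (-G y)

_*G_ : ℤ[i] → ℤ[i] → ℤ[i]
(a + b i) *G (c + d i) = (a ℤ.* c ℤ.- b ℤ.* d) + (a ℤ.* d ℤ.+ b ℤ.* c) i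

0G 1G iG 1+i : ℤ[i]
0G = (+ 0) + (+ 0) i
1G = (+ 1) + (+ 0) i
iG = (+ 0) + (+ 1) i
1+i = (+ 1) + (+ 1) i

_^G_ : ℤ[i] → ℕ → ℤ[i]
x ^G zero = 1G
x ^G suc n = x *G (x ^G n)

_∣G_ : ℤ[i] → ℤ[i] → Set
β ∣G x = ∃ λ γ → x ≡ β *G γ

_≡_[mod_] : ℤ[i] → ℤ[i] → ℤ[i] → Set
x ≡ y [mod β ] = β ∣G (x -G y)

Digit : ℤ[i] → Set
Digit x = (x ≡ 0G) ⊎ (x ≡ 1G) ⊎ (x ≡ -G 1G) ⊎ (x ≡ iG) ⊎ (x ≡ -G iG)

A : ℕ → ℤ[i] → Set
A zero x = Digit x
A (suc n) β = A n β ⊎ (∀ (x : ℤ[i]) → ∃ λ y → A n y × (x ≡ y [mod β ]))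

ΣFin : (m : ℕ) → (Fin m → ℤ[i]) → ℤ[i]
ΣFin zero f = 0G
ΣFin (suc m) f = f fzero +G ΣFin m (λ j → f (fsuc j))

B : ℕ → ℤ[i] → Set
B n x = Σ (Fin (suc n) → ℤ[i]) λ v →
          (∀ j → Digit (v j)) × (x ≡ ΣFin (suc n) (λ j → v j *G (1+i ^G toℕ j)))

{-# OPTIONS --safe #-}
-- Every Gaussian integer is d + (1+i) w with d ∈ {0, 1}.  Hence if the residues
-- modulo β are represented by A_{n-1}, the residues modulo (1+i) β are represented
-- by the numbers d + (1+i) a with a ∈ A_{n-1} = B_{n-1}, and these lie in
-- B_n = A_n.  An induction on n handles the β that already lie in A_{n-1}; at the
-- bottom, a nonzero digit is a unit, so the residues modulo (1+i) β are just 0 and 1.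
module Submission where

open import Defs
open import Data.Nat using (ℕ; zero; suc; _≤_; s≤s)
open import Data.Nat.Properties using (≤-refl; m≤n⇒m≤1+n)
open import Data.Integer as ℤ using (ℤ; +_)
open import Data.Integer.DivMod using (a≡a%ℕn+[a/ℕn]*n; n%ℕd<d)
open import Data.Integer.Tactic.RingSolver using (solve-∀)
open import Data.Fin using (Fin; toℕ) renaming (zero to fzero; suc to fsuc)
open import Data.Product using (∃; ∃₂; _×_; _,_; proj₁; proj₂)
open import Data.Sum using (_⊎_; inj₁; inj₂)
open import Relation.Binary.PropositionalEquality
  using (_≡_; refl; sym; trans; cong; cong₂; module ≡-Reasoning)

*G-assoc : ∀ x y z → x *G (y *G z) ≡ (x *G y) *G z
*G-assoc (a + b i) (c + d i) (e + f i) = cong₂ _+_i (re-assoc a b c d e f) (im-assoc a b c d e f)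
  where
  re-assoc : ∀ a b c d e f → a ℤ.* (c ℤ.* e ℤ.- d ℤ.* f) ℤ.- b ℤ.* (c ℤ.* f ℤ.+ d ℤ.* e)
                             ≡ (a ℤ.* c ℤ.- b ℤ.* d) ℤ.* e ℤ.- (a ℤ.* d ℤ.+ b ℤ.* c) ℤ.* f
  re-assoc = solve-∀
  im-assoc : ∀ a b c d e f → a ℤ.* (c ℤ.* f ℤ.+ d ℤ.* e) ℤ.+ b ℤ.* (c ℤ.* e ℤ.- d ℤ.* f)
                             ≡ (a ℤ.* c ℤ.- b ℤ.* d) ℤ.* f ℤ.+ (a ℤ.* d ℤ.+ b ℤ.* c) ℤ.* e
  im-assoc = solve-∀

*G-comm : ∀ x y → x *G y ≡ y *G x
*G-comm (a + b i) (c + d i) = cong₂ _+_i (re-comm a b c d) (im-comm a b c d)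
  where
  re-comm : ∀ a b c d → a ℤ.* c ℤ.- b ℤ.* d ≡ c ℤ.* a ℤ.- d ℤ.* b
  re-comm = solve-∀
  im-comm : ∀ a b c d → a ℤ.* d ℤ.+ b ℤ.* c ≡ c ℤ.* b ℤ.+ d ℤ.* a
  im-comm = solve-∀

*G-distribˡ-+G : ∀ x y z → x *G (y +G z) ≡ x *G y +G x *G z
*G-distribˡ-+G (a + b i) (c + d i) (e + f i) = cong₂ _+_i (re-distrib a b c d e f) (im-distrib a b c d e f)
  where
  re-distrib : ∀ a b c d e f → a ℤ.* (c ℤ.+ e) ℤ.- b ℤ.* (d ℤ.+ f)
                               ≡ (a ℤ.* c ℤ.- b ℤ.* d) ℤ.+ (a ℤ.* e ℤ.- b ℤ.* f)
  re-distrib = solve-∀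
  im-distrib : ∀ a b c d e f → a ℤ.* (d ℤ.+ f) ℤ.+ b ℤ.* (c ℤ.+ e)
                               ≡ (a ℤ.* d ℤ.+ b ℤ.* c) ℤ.+ (a ℤ.* f ℤ.+ b ℤ.* e)
  im-distrib = solve-∀

*G-zeroʳ : ∀ x → x *G 0G ≡ 0G
*G-zeroʳ (a + b i) = cong₂ _+_i (re-zero a b) (im-zero a b)
  where
  re-zero : ∀ a b → a ℤ.* + 0 ℤ.- b ℤ.* + 0 ≡ + 0
  re-zero = solve-∀
  im-zero : ∀ a b → a ℤ.* + 0 ℤ.+ b ℤ.* + 0 ≡ + 0
  im-zero = solve-∀

*G-identityˡ : ∀ x → 1G *G x ≡ x
*G-identityˡ (a + b i) = cong₂ _+_i (re-identity a b) (im-identity a b)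
  where
  re-identity : ∀ a b → + 1 ℤ.* a ℤ.- + 0 ℤ.* b ≡ a
  re-identity = solve-∀
  im-identity : ∀ a b → + 1 ℤ.* b ℤ.+ + 0 ℤ.* a ≡ b
  im-identity = solve-∀

*G-identityʳ : ∀ x → x *G 1G ≡ x
*G-identityʳ x = trans (*G-comm x 1G) (*G-identityˡ x)

d+xy-[d+xz]≡x[y-z] : ∀ d x y z → (d +G x *G y) -G (d +G x *G z) ≡ x *G (y -G z)
d+xy-[d+xz]≡x[y-z] (d₁ + d₂ i) (x₁ + x₂ i) (y₁ + y₂ i) (z₁ + z₂ i) =
  cong₂ _+_i (re-sub d₁ d₂ x₁ x₂ y₁ y₂ z₁ z₂) (im-sub d₁ d₂ x₁ x₂ y₁ y₂ z₁ z₂)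
  where
  re-sub : ∀ d₁ d₂ x₁ x₂ y₁ y₂ z₁ z₂ →
    (d₁ ℤ.+ (x₁ ℤ.* y₁ ℤ.- x₂ ℤ.* y₂)) ℤ.+ ℤ.- (d₁ ℤ.+ (x₁ ℤ.* z₁ ℤ.- x₂ ℤ.* z₂))
    ≡ x₁ ℤ.* (y₁ ℤ.+ ℤ.- z₁) ℤ.- x₂ ℤ.* (y₂ ℤ.+ ℤ.- z₂)
  re-sub = solve-∀
  im-sub : ∀ d₁ d₂ x₁ x₂ y₁ y₂ z₁ z₂ →
    (d₂ ℤ.+ (x₁ ℤ.* y₂ ℤ.+ x₂ ℤ.* y₁)) ℤ.+ ℤ.- (d₂ ℤ.+ (x₁ ℤ.* z₂ ℤ.+ x₂ ℤ.* z₁))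
    ≡ x₁ ℤ.* (y₂ ℤ.+ ℤ.- z₂) ℤ.+ x₂ ℤ.* (y₁ ℤ.+ ℤ.- z₁)
  im-sub = solve-∀

ΣFin-cong : ∀ m {f g : Fin m → ℤ[i]} → (∀ j → f j ≡ g j) → ΣFin m f ≡ ΣFin m g
ΣFin-cong zero    f≡g = refl
ΣFin-cong (suc m) f≡g = cong₂ _+G_ (f≡g fzero) (ΣFin-cong m (λ j → f≡g (fsuc j)))

*G-distribˡ-ΣFin : ∀ m x (f : Fin m → ℤ[i]) → x *G ΣFin m f ≡ ΣFin m (λ j → x *G f j)
*G-distribˡ-ΣFin zero    x f = *G-zeroʳ x
*G-distribˡ-ΣFin (suc m) x f =
  trans (*G-distribˡ-+G x (f fzero) _) (cong (x *G f fzero +G_) (*G-distribˡ-ΣFin m x (λ j → f (fsuc j))))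

Unit : ℤ[i] → Set
Unit u = ∃ λ v → u *G v ≡ 1G

unit-∣G : ∀ u → Unit u → ∀ x → u ∣G x
unit-∣G u (v , uv≡1) x = v *G x , (begin
  x               ≡⟨ *G-identityˡ x ⟨
  1G *G x         ≡⟨ cong (_*G x) uv≡1 ⟨
  (u *G v) *G x   ≡⟨ *G-assoc u v x ⟨
  u *G (v *G x)   ∎)
  where open ≡-Reasoning

digit-zero-or-unit : ∀ {u} → Digit u → u ≡ 0G ⊎ Unit u
digit-zero-or-unit (inj₁ u≡0)                       = inj₁ u≡0
digit-zero-or-unit (inj₂ (inj₁ refl))               = inj₂ (1G , refl)
digit-zero-or-unit (inj₂ (inj₂ (inj₁ refl)))        = inj₂ (-G 1G , refl)
digit-zero-or-unit (inj₂ (inj₂ (inj₂ (inj₁ refl)))) = inj₂ (-G iG , refl)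
digit-zero-or-unit (inj₂ (inj₂ (inj₂ (inj₂ refl)))) = inj₂ (iG , refl)

Bit : ℤ[i] → Set
Bit d = d ≡ 0G ⊎ d ≡ 1G

bit-digit : ∀ {d} → Bit d → Digit d
bit-digit (inj₁ d≡0) = inj₁ d≡0
bit-digit (inj₂ d≡1) = inj₂ (inj₁ d≡1)

ℤ-divMod-2 : ∀ s → ∃₂ λ e k → (e ≡ + 0 ⊎ e ≡ + 1) × s ≡ e ℤ.+ k ℤ.* + 2
ℤ-divMod-2 s with s ℤ.%ℕ 2 | n%ℕd<d s 2 | a≡a%ℕn+[a/ℕn]*n s 2
... | 0           | _                 | s≡ = + 0 , s ℤ./ℕ 2 , inj₁ refl , s≡
... | 1           | _                 | s≡ = + 1 , s ℤ./ℕ 2 , inj₂ refl , s≡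
... | suc (suc _) | s≤s (s≤s ())      | _

-- The residue of z modulo 1+i is the parity of re z + im z.
bit+1+i* : ∀ z → ∃₂ λ d w → Bit d × z ≡ d +G 1+i *G w
bit+1+i* (a + b i) with ℤ-divMod-2 (a ℤ.+ b)
... | e , k , e-bit , a+b≡ =
  e + + 0 i , k + (k ℤ.- a ℤ.+ e) i , bit e-bit ,
  cong₂ _+_i (re≡ a e k) (trans (b≡ a+b≡) (im≡ a e k))
  where
  bit : e ≡ + 0 ⊎ e ≡ + 1 → Bit (e + + 0 i)
  bit (inj₁ refl) = inj₁ refl
  bit (inj₂ refl) = inj₂ refl
  re≡ : ∀ a e k → a ≡ e ℤ.+ (+ 1 ℤ.* k ℤ.- + 1 ℤ.* (k ℤ.- a ℤ.+ e))
  re≡ = solve-∀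
  a+b-a≡b : ∀ a b → (a ℤ.+ b) ℤ.- a ≡ b
  a+b-a≡b = solve-∀
  b≡ : a ℤ.+ b ≡ e ℤ.+ k ℤ.* + 2 → b ≡ (e ℤ.+ k ℤ.* + 2) ℤ.- a
  b≡ h = trans (sym (a+b-a≡b a b)) (cong (ℤ._- a) h)
  im≡ : ∀ a e k → (e ℤ.+ k ℤ.* + 2) ℤ.- a ≡ + 0 ℤ.+ (+ 1 ℤ.* (k ℤ.- a ℤ.+ e) ℤ.+ + 1 ℤ.* k)
  im≡ = solve-∀

RepresentsResidues : (ℤ[i] → Set) → ℤ[i] → Set
RepresentsResidues S β = ∀ z → ∃ λ y → S y × z ≡ y [mod β ]

representsResidues-1+i* : ∀ {S T : ℤ[i] → Set} β →
  (∀ {d a} → Bit d → S a → T (d +G 1+i *G a)) →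
  RepresentsResidues S β → RepresentsResidues T (1+i *G β)
representsResidues-1+i* β lift S-reps z with bit+1+i* z
... | d , w , d-bit , z≡ with S-reps w
... | a , a∈S , γ , w-a≡βγ = d +G 1+i *G a , lift d-bit a∈S , γ , (begin
  z -G (d +G 1+i *G a)                ≡⟨ cong (_-G (d +G 1+i *G a)) z≡ ⟩
  (d +G 1+i *G w) -G (d +G 1+i *G a)  ≡⟨ d+xy-[d+xz]≡x[y-z] d 1+i w a ⟩
  1+i *G (w -G a)                     ≡⟨ cong (1+i *G_) w-a≡βγ ⟩
  1+i *G (β *G γ)                     ≡⟨ *G-assoc 1+i β γ ⟩
  (1+i *G β) *G γ                     ∎)
  where open ≡-Reasoning

B-digit+1+i* : ∀ m {d a} → Digit d → B m a → B (suc m) (d +G 1+i *G a)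
B-digit+1+i* m {d} {a} d-digit (u , u-digits , a≡) = v , v-digits , (begin
  d +G 1+i *G a
    ≡⟨ cong₂ _+G_ (sym (*G-identityʳ d)) (cong (1+i *G_) a≡) ⟩
  d *G 1G +G 1+i *G ΣFin (suc m) (λ j → u j *G 1+i ^G toℕ j)
    ≡⟨ cong (d *G 1G +G_) (*G-distribˡ-ΣFin (suc m) 1+i (λ j → u j *G 1+i ^G toℕ j)) ⟩
  d *G 1G +G ΣFin (suc m) (λ j → 1+i *G (u j *G 1+i ^G toℕ j))
    ≡⟨ cong (d *G 1G +G_) (ΣFin-cong (suc m) (λ j → x[yz]≡y[xz] 1+i (u j) (1+i ^G toℕ j))) ⟩
  ΣFin (suc (suc m)) (λ j → v j *G 1+i ^G toℕ j) ∎)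
  where
  open ≡-Reasoning
  v : Fin (suc (suc m)) → ℤ[i]
  v fzero    = d
  v (fsuc j) = u j
  v-digits : ∀ j → Digit (v j)
  v-digits fzero    = d-digit
  v-digits (fsuc j) = u-digits j
  x[yz]≡y[xz] : ∀ x y z → x *G (y *G z) ≡ y *G (x *G z)
  x[yz]≡y[xz] x y z =
    trans (*G-assoc x y z) (trans (cong (_*G z) (*G-comm x y)) (sym (*G-assoc y x z)))

AgreesUpTo : ℕ → Set
AgreesUpTo n = (j : ℕ) → j ≤ n → (x : ℤ[i]) → (A j x → B j x) × (B j x → A j x)

agreesUpTo-pred : ∀ {m} → AgreesUpTo (suc m) → AgreesUpTo m
agreesUpTo-pred agree j j≤m = agree j (m≤n⇒m≤1+n j≤m)

A-1+i* : ∀ n → AgreesUpTo n → ∀ β → A n β → A (suc n) (1+i *G β)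
A-1+i* zero    agree β β-digit with digit-zero-or-unit β-digit
... | inj₁ refl   = inj₁ (inj₁ refl)
... | inj₂ β-unit = inj₂ (representsResidues-1+i* β bit-lift zero-represents)
  where
  zero-represents : RepresentsResidues (_≡ 0G) β
  zero-represents z = 0G , refl , unit-∣G β β-unit (z -G 0G)
  bit-lift : ∀ {d a} → Bit d → a ≡ 0G → Digit (d +G 1+i *G a)
  bit-lift (inj₁ refl) refl = inj₁ refl
  bit-lift (inj₂ refl) refl = inj₂ (inj₁ refl)
A-1+i* (suc m) agree β (inj₁ β∈Aₘ)    = inj₁ (A-1+i* m (agreesUpTo-pred agree) β β∈Aₘ)
A-1+i* (suc m) agree β (inj₂ Aₘ-reps) = inj₂ (representsResidues-1+i* β lift Aₘ-reps)
  where
  lift : ∀ {d a} → Bit d → A m a → A (suc m) (d +G 1+i *G a)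
  lift {d} {a} d-bit a∈Aₘ =
    proj₂ (agree (suc m) ≤-refl (d +G 1+i *G a))
      (B-digit+1+i* m (bit-digit d-bit) (proj₁ (agree m (m≤n⇒m≤1+n ≤-refl) a) a∈Aₘ))

mainTheorem9 : (n : ℕ) →
    ((j : ℕ) → j ≤ n → (x : ℤ[i]) → (A j x → B j x) × (B j x → A j x)) →
    (x : ℤ[i]) → B n x → A (suc n) (1+i *G x)
mainTheorem9 n agree x x∈Bₙ = A-1+i* n agree x (proj₂ (agree n ≤-refl x) x∈Bₙ)
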